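{- Let $G$ be a $k$-colorable $B+E_\ell$ graph, with based bipartite graph having partite sets $S$ and $T$, and let $E_T$ denote the set of added edges joining two vertices of $T$. Let $f$ be a $k$-coloring of $G$ and let $i \neq j$ be colors in $\{1,\dots,k\}$. (i) If no vertex of $S$ has color $i$ under $f$ and no edge of $E_T$ has one endpoint colored $i$ and the other colored $j$, then $f$ is Kempe equivalent to a $k$-coloring of $G$ in which no vertex of $T$ has color $j$. (ii) If a vertex $v \in T$ with $f(v)=j$ is not adjacent to any vertex of color $i$, then $f$ is Kempe equivalent to the $k$-coloring $g$ with $g(v) = i$ and $g(u) = f(u)$ for all $u \neq v$.
   Context: All graphs are finite and simple. A $k$-coloring of a graph $G$ is a map $c: V(G) \to \{1,\dots,k\}$ with $c(u)\neq c(v)$ for every edge $uv$ (not all colors need be used). A Kempe change swaps two colors $i,j$ on one connected component of the subgraph induced by vertices colored $i$ or $j$. Two $k$-colorings are Kempe equivalent if one is obtained from the other by a finite sequence of Kempe changes (possibly with different color pairs from $\{1,\dots,k\}$). A $B+E_\ell$ graph is a graph obtained from a bipartite graph $B$ (the based bipartite graph) with partite sets $S$ and $T$ by adding $\ell$ new edges, each joining two vertices lying in the same partite set. -}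

module Defs where

open import Data.Nat using (ℕ)
open import Data.Fin using (Fin; _≟_)
open import Data.Bool using (if_then_else_)
open import Data.Product using (_×_; _,_; Σ; ∃; ∃-syntax)
open import Data.Sum using (_⊎_)
open import Data.Vec using (Vec; lookup)
open import Data.Vec.Membership.Propositional using (_∈_)
open import Relation.Nullary using (¬_; Dec)
open import Relation.Nullary.Decidable using (⌊_⌋)
open import Relation.Binary using (Decidable)
open import Relation.Binary.PropositionalEquality using (_≡_; _≢_)
open import Relation.Binary.Construct.Closure.ReflexiveTransitive using (Star)

data Side : Set where
  S T : Side

-- A B+E_ℓ graph on vertex set Fin n: a bipartite graph B (adjacency AdjB,
-- every edge joins S to T) plus ℓ new edges, each joining two distinct
-- vertices on the same side, pairwise distinct as unordered pairs.
record BplusE (n ℓ : ℕ) : Set₁ where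
  field
    side      : Fin n → Side
    AdjB      : Fin n → Fin n → Set
    AdjB-sym  : ∀ {u v} → AdjB u v → AdjB v u
    AdjB-dec  : Decidable AdjB
    AdjB-bip  : ∀ {u v} → AdjB u v → side u ≢ side v
    added     : Vec (Fin n × Fin n) ℓ
    added-same : ∀ {u v} → (u , v) ∈ added → side u ≡ side v
    added-loopless : ∀ {u v} → (u , v) ∈ added → u ≢ v
    added-distinct : ∀ (p q : Fin ℓ) → p ≢ q →
      ∀ u v → lookup added p ≡ (u , v) →
        (lookup added q ≢ (u , v)) × (lookup added q ≢ (v , u))

  AddedEdge : Fin n → Fin n → Set
  AddedEdge u v = ((u , v) ∈ added) ⊎ ((v , u) ∈ added)

  Adj : Fin n → Fin n → Set
  Adj u v = AdjB u v ⊎ AddedEdge u v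

  ET : Fin n → Fin n → Set
  ET u v = AddedEdge u v × side u ≡ T × side v ≡ T

module _ {n : ℕ} (Adj : Fin n → Fin n → Set) {k : ℕ} where

  IsColoring : (Fin n → Fin k) → Set
  IsColoring c = ∀ u v → Adj u v → c u ≢ c v

  -- Reach c i j v u : u lies in the connected component containing v of the
  -- subgraph induced by the vertices colored i or j under c.
  data Reach (c : Fin n → Fin k) (i j : Fin k) : Fin n → Fin n → Set where
    here : ∀ {v} → (c v ≡ i ⊎ c v ≡ j) → Reach c i j v v
    step : ∀ {v w x} → Reach c i j v w → Adj w x → (c x ≡ i ⊎ c x ≡ j) →
           Reach c i j v x

  swapCol : Fin k → Fin k → Fin k → Fin k
  swapCol i j x = if ⌊ x ≟ i ⌋ then j else (if ⌊ x ≟ j ⌋ then i else x)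

  KempeChange : (Fin n → Fin k) → (Fin n → Fin k) → Set
  KempeChange c d = Σ (Fin k) λ i → Σ (Fin k) λ j → Σ (Fin n) λ v →
    (c v ≡ i ⊎ c v ≡ j) ×
    (∀ u → (Reach c i j v u → d u ≡ swapCol i j (c u)) ×
           (¬ Reach c i j v u → d u ≡ c u))

  KempeEquiv : (Fin n → Fin k) → (Fin n → Fin k) → Set
  KempeEquiv = Star KempeChange

{-# OPTIONS --safe #-}
-- A vertex of colour j none of whose neighbours has colour i is a component
-- of the {i,j}-subgraph on its own, so recolouring it to i is a Kempe change;
-- this is (ii). For (i), every vertex of T coloured j is such a vertex: its
-- S-neighbours avoid i by hypothesis, and its T-neighbours are joined to it by
-- an E_T edge, which cannot be an (i,j)-edge. These vertices are pairwise
-- non-adjacent (all have colour j), so they can be recoloured to i one at a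
-- time, each step remaining a single-vertex Kempe change.
module Submission where

open import Defs
open import Data.Nat using (ℕ)
open import Data.Fin using (Fin; _≟_)
open import Data.Product using (_×_; Σ; _,_; proj₁)
open import Data.Sum using (_⊎_; inj₁; inj₂; [_,_])
import Data.Sum as Sum
open import Data.Empty using (⊥-elim)
open import Data.List using (List; []; _∷_; allFin; filter)
open import Data.List.Relation.Unary.All using (All; []; _∷_)
import Data.List.Relation.Unary.All as All
open import Data.List.Relation.Unary.All.Properties using (all-filter)
open import Data.List.Relation.Unary.Any using (here; there)
open import Data.List.Membership.Propositional using (_∈_)
open import Data.List.Membership.Propositional.Properties using (∈-allFin; ∈-filter⁺)
open import Relation.Nullary using (¬_; Dec; yes; no)
open import Relation.Nullary.Decidable using (_×-dec_)
open import Relation.Binary using (Symmetric)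
open import Relation.Binary.PropositionalEquality
  using (_≡_; _≢_; refl; sym; trans; cong)
open import Relation.Binary.Construct.Closure.ReflexiveTransitive using (ε; _◅_; _◅◅_)

_≟Side_ : (a b : Side) → Dec (a ≡ b)
S ≟Side S = yes refl
S ≟Side T = no λ ()
T ≟Side S = no λ ()
T ≟Side T = yes refl

module Recolouring {n : ℕ} (Adj : Fin n → Fin n → Set) {k : ℕ} where

  swapCol-right : (i j : Fin k) → swapCol Adj i j j ≡ i
  swapCol-right i j with j ≟ i
  ... | yes j≡i = j≡i
  ... | no _ with j ≟ j
  ...   | yes _ = refl
  ...   | no j≢j = ⊥-elim (j≢j refl)

  swapCol-diag : (a x : Fin k) → swapCol Adj a a x ≡ x
  swapCol-diag a x with x ≟ a
  ... | yes x≡a = sym x≡a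
  ... | no _ = refl

  kempeChange-trivial : ∀ {c d : Fin n → Fin k} → Fin n → (∀ u → d u ≡ c u) → KempeChange Adj c d
  kempeChange-trivial {c} v d≗c = c v , c v , v , inj₁ refl , λ u →
    (λ _ → trans (d≗c u) (sym (swapCol-diag (c v) (c u)))) , (λ _ → d≗c u)

  reach-isolated : ∀ {c : Fin n → Fin k} {i j v u} → IsColoring Adj c → c v ≡ j →
    (∀ w → Adj v w → c w ≢ i) → Reach Adj c i j v u → u ≡ v
  reach-isolated c-proper cv≡j noI (here _) = refl
  reach-isolated c-proper cv≡j noI (step r vw cw) with reach-isolated c-proper cv≡j noI r
  ... | refl = ⊥-elim ([ noI _ vw , (λ cw≡j → c-proper _ _ vw (trans cv≡j (sym cw≡j))) ] cw)

  recolour-kempeChange : ∀ {c d : Fin n → Fin k} (i j : Fin k) (v : Fin n) → IsColoring Adj c →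
    c v ≡ j → (∀ u → Adj v u → c u ≢ i) →
    d v ≡ i → (∀ u → u ≢ v → d u ≡ c u) → KempeChange Adj c d
  recolour-kempeChange {c} {d} i j v c-proper cv≡j noI dv≡i d-elsewhere =
    i , j , v , inj₂ cv≡j , λ u → inside u , outside u
    where
    inside : ∀ u → Reach Adj c i j v u → d u ≡ swapCol Adj i j (c u)
    inside u r with reach-isolated c-proper cv≡j noI r
    ... | refl = trans dv≡i (sym (trans (cong (swapCol Adj i j) cv≡j) (swapCol-right i j)))
    outside : ∀ u → ¬ Reach Adj c i j v u → d u ≡ c u
    outside u ¬r = d-elsewhere u λ { refl → ¬r (here (inj₂ cv≡j)) }

  recolour : Fin n → Fin k → (Fin n → Fin k) → Fin n → Fin k
  recolour v a c u with u ≟ v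
  ... | yes _ = a
  ... | no _ = c u

  recolour-self : ∀ v a c → recolour v a c v ≡ a
  recolour-self v a c with v ≟ v
  ... | yes _ = refl
  ... | no v≢v = ⊥-elim (v≢v refl)

  recolour-other : ∀ v a c u → u ≢ v → recolour v a c u ≡ c u
  recolour-other v a c u u≢v with u ≟ v
  ... | yes u≡v = ⊥-elim (u≢v u≡v)
  ... | no _ = refl

  recolour-unchanged : ∀ v a c → c v ≡ a → ∀ u → recolour v a c u ≡ c u
  recolour-unchanged v a c cv≡a u with u ≟ v
  ... | yes refl = sym cv≡a
  ... | no _ = refl

  recolour-isColoring : Symmetric Adj → ∀ {c} v a → IsColoring Adj c →
    (∀ u → Adj v u → c u ≢ a) → IsColoring Adj (recolour v a c)
  recolour-isColoring adj-sym v a c-proper noA u w uw with u ≟ v | w ≟ v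
  ... | yes refl | yes refl = ⊥-elim (c-proper v v uw refl)
  ... | yes refl | no _ = λ a≡cw → noA w uw (sym a≡cw)
  ... | no _ | yes refl = noA u (adj-sym uw)
  ... | no _ | no _ = c-proper u w uw

module Painting {n : ℕ} (Adj : Fin n → Fin n → Set) (adj-sym : Symmetric Adj) {k : ℕ}
  (f : Fin n → Fin k) (f-proper : IsColoring Adj f) (i j : Fin k) where
  open Recolouring Adj {k}

  Paintable : Fin n → Set
  Paintable x = f x ≡ j × (∀ u → Adj x u → f u ≢ i)

  paint : List (Fin n) → Fin n → Fin k
  paint [] = f
  paint (x ∷ L) = recolour x i (paint L)

  paint-cases : ∀ {L} → All Paintable L → ∀ u → paint L u ≡ f u ⊎ (f u ≡ j × paint L u ≡ i)
  paint-cases [] u = inj₁ refl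
  paint-cases {x ∷ L} (px ∷ pL) u with u ≟ x
  ... | yes refl = inj₂ (proj₁ px , refl)
  ... | no _ = paint-cases pL u

  -- Painted vertices have colour j under f, so properness of f keeps them off the neighbourhood of x.
  paint-neighbour≢i : ∀ {L x} → All Paintable L → Paintable x → ∀ u → Adj x u → paint L u ≢ i
  paint-neighbour≢i pL (fx≡j , noI) u xu with paint-cases pL u
  ... | inj₁ pu≡fu = λ pu≡i → noI u xu (trans (sym pu≡fu) pu≡i)
  ... | inj₂ (fu≡j , _) = λ _ → f-proper _ u xu (trans fx≡j (sym fu≡j))

  paint-isColoring : ∀ {L} → All Paintable L → IsColoring Adj (paint L)
  paint-isColoring [] = f-proper
  paint-isColoring {x ∷ L} (px ∷ pL) =
    recolour-isColoring adj-sym x i (paint-isColoring pL) (paint-neighbour≢i pL px)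

  paint-kempeEquiv : ∀ {L} → All Paintable L → KempeEquiv Adj f (paint L)
  paint-kempeEquiv [] = ε
  paint-kempeEquiv {x ∷ L} (px ∷ pL) = paint-kempeEquiv pL ◅◅ (paint-step ◅ ε)
    where
    paint-step : KempeChange Adj (paint L) (paint (x ∷ L))
    paint-step with paint-cases pL x
    ... | inj₁ px≡fx = recolour-kempeChange i j x (paint-isColoring pL)
      (trans px≡fx (proj₁ px)) (paint-neighbour≢i pL px)
      (recolour-self x i (paint L)) (recolour-other x i (paint L))
    ... | inj₂ (_ , px≡i) = kempeChange-trivial x (recolour-unchanged x i (paint L) px≡i)

  paint-covers : ∀ {L x} → x ∈ L → paint L x ≡ i
  paint-covers {x = x} (here refl) = recolour-self x i _
  paint-covers {y ∷ L} {x} (there x∈L) with x ≟ y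
  ... | yes _ = refl
  ... | no _ = paint-covers x∈L

module BplusE-Kempe {n ℓ k : ℕ} (G : BplusE n ℓ) where
  open BplusE G

  Adj-sym : Symmetric Adj
  Adj-sym (inj₁ uv) = inj₁ (AdjB-sym uv)
  Adj-sym (inj₂ uv) = inj₂ (Sum.swap uv)

  T-neighbour≢i : (f : Fin n → Fin k) (i j : Fin k) →
    (∀ u → side u ≡ S → f u ≢ i) → (∀ u v → ET u v → f u ≡ i → f v ≢ j) →
    ∀ x → side x ≡ T → f x ≡ j → ∀ u → Adj x u → f u ≢ i
  T-neighbour≢i f i j noS noET x sx fx≡j u xu fu≡i with side u in su
  ... | S = noS u su fu≡i
  ... | T with xu
  ...   | inj₁ xuB = AdjB-bip xuB (trans sx (sym su))
  ...   | inj₂ xuE = noET u x (Sum.swap xuE , su , sx) fu≡i fx≡j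

  eliminate-j-from-T : (f : Fin n → Fin k) → IsColoring Adj f → (i j : Fin k) → i ≢ j →
    (∀ u → side u ≡ S → f u ≢ i) → (∀ u v → ET u v → f u ≡ i → f v ≢ j) →
    Σ (Fin n → Fin k) λ g → IsColoring Adj g × KempeEquiv Adj f g × (∀ u → side u ≡ T → g u ≢ j)
  eliminate-j-from-T f f-proper i j i≢j noS noET =
    paint L , paint-isColoring paintable , paint-kempeEquiv paintable , avoids-j
    where
    open Painting Adj Adj-sym f f-proper i j
    Tj? : ∀ u → Dec (side u ≡ T × f u ≡ j)
    Tj? u = (side u ≟Side T) ×-dec (f u ≟ j)
    L : List (Fin n)
    L = filter Tj? (allFin n)
    paintable : All Paintable L
    paintable = All.map (λ {x} (sx , fx≡j) → fx≡j , T-neighbour≢i f i j noS noET x sx fx≡j)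
                        (all-filter Tj? (allFin n))
    avoids-j : ∀ u → side u ≡ T → paint L u ≢ j
    avoids-j u su gu≡j with paint-cases paintable u
    ... | inj₁ gu≡fu = i≢j (trans (sym (paint-covers u∈L)) gu≡j)
      where
      u∈L : u ∈ L
      u∈L = ∈-filter⁺ Tj? (∈-allFin u) (su , trans (sym gu≡fu) gu≡j)
    ... | inj₂ (_ , gu≡i) = i≢j (trans (sym gu≡i) gu≡j)

lemma1 : ∀ {n ℓ k : ℕ} (G : BplusE n ℓ) →
    let open BplusE G in
    (f : Fin n → Fin k) → IsColoring Adj f →
    (i j : Fin k) → i ≢ j →
    ((∀ u → side u ≡ S → f u ≢ i) →
     (∀ u v → ET u v → f u ≡ i → f v ≢ j) →
     Σ (Fin n → Fin k) λ g → IsColoring Adj g × KempeEquiv Adj f g ×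
       (∀ u → side u ≡ T → g u ≢ j))
    ×
    (∀ v → side v ≡ T → f v ≡ j → (∀ u → Adj v u → f u ≢ i) →
     (g : Fin n → Fin k) → g v ≡ i → (∀ u → u ≢ v → g u ≡ f u) →
     KempeEquiv Adj f g)
lemma1 G f f-proper i j i≢j =
  eliminate-j-from-T f f-proper i j i≢j ,
  λ v _ fv≡j noI g gv≡i g-elsewhere →
    recolour-kempeChange i j v f-proper fv≡j noI gv≡i g-elsewhere ◅ ε
  where
  open BplusE-Kempe G
  open Recolouring (BplusE.Adj G)
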